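{- Let $\Gamma$ be an infinite abelian group and $F\colon\Gamma\to\Gamma$ an injective endomorphism, and suppose $\Gamma$ admits an $F^r$-spanning set for some $r>0$. Let $S\subseteq\Gamma$ be a finite set containing a representative of each coset of $F\Gamma$ in $\Gamma$. Then a subset $A\subseteq\Gamma$ is $F$-automatic if and only if the $(S,F)$-kernel of $A$ is finite.
   Context: For a string $\sigma=s_0\cdots s_n$ of elements of $\Gamma$ and an endomorphism $G$, $[\sigma]_G=s_0+Gs_1+\cdots+G^ns_n$. $\Lambda^*$ denotes finite strings over $\Lambda$. A finite $\Sigma\subseteq\Gamma$ is a $G$-spanning set if: (i) every $a\in\Gamma$ equals $[\sigma]_G$ for some $\sigma\in\Sigma^*$; (ii) $0\in\Sigma$ and $\Sigma=-\Sigma$; (iii) for $a_1,\dots,a_5\in\Sigma$, $a_1+\cdots+a_5\in\Sigma+G\Sigma$; (iv) if $a_1,a_2,a_3\in\Sigma$ and $a_1+a_2+a_3\in G\Gamma$ then $a_1+a_2+a_3\in G\Sigma$. $A\subseteq\Gamma$ is $F$-automatic if there are $r>0$ and an $F^r$-spanning set $\Sigma$ such that $\{\sigma\in\Sigma^*:[\sigma]_{F^r}\in A\}$ is a regular language over the alphabet $\Sigma$. For $A\subseteq\Gamma$ and $s_0,\dots,s_{n-1}\in\Gamma$, let $A_{s_0\cdots s_{n-1}}=\{x\in\Gamma: s_0+Fs_1+\cdots+F^{n-1}s_{n-1}+F^nx\in A\}$ (so $A_\epsilon=A$ for the empty string). The $(S,F)$-kernel of $A$ is $\{A_\sigma:\sigma\in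 S^*\}$. -}

module Defs where

open import Level using (Level; _⊔_)
open import Algebra.Bundles using (AbelianGroup)
open import Algebra.Morphism.Structures using (module GroupMorphisms)
open import Data.Nat using (ℕ; zero; suc; _<_)
open import Data.Fin using (Fin)
open import Data.List using (List; []; _∷_; map; foldl)
open import Data.Bool using (Bool)
open import Data.Product using (Σ; Σ-syntax; _×_; ∃; ∃-syntax; _,_)
open import Relation.Nullary using (¬_)
open import Relation.Binary.PropositionalEquality using (_≡_)
open import Function.Definitions using (Injective)

record DFA (k : ℕ) : Set where
  field
    nStates : ℕ
    δ       : Fin nStates → Fin k → Fin nStates
    start   : Fin nStates
    accept  : Fin nStates → Bool

  run : List (Fin k) → Fin nStates
  run w = foldl δ start w

  accepts : List (Fin k) → Bool
  accepts w = accept (run w)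

IsRegular : (k : ℕ) → (List (Fin k) → Bool) → Set
IsRegular k L = Σ[ M ∈ DFA k ] (∀ w → DFA.accepts M w ≡ L w)

-- Everything below is relative to an abelian group Γ (written
-- multiplicatively in the stdlib: _∙_ is +, ε is 0, _⁻¹ is negation).

module _ {c ℓ : Level} (Γ : AbelianGroup c ℓ) where
  open AbelianGroup Γ

  IsInjectiveEndo : (Carrier → Carrier) → Set (c ⊔ ℓ)
  IsInjectiveEndo F = GroupMorphisms.IsGroupMonomorphism rawGroup rawGroup F

  IsInfinite : Set (c ⊔ ℓ)
  IsInfinite = ¬ (Σ[ n ∈ ℕ ] Σ[ f ∈ (Fin n → Carrier) ] (∀ x → ∃[ i ] (f i ≈ x)))

  _^[_] : (Carrier → Carrier) → ℕ → Carrier → Carrier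
  (F ^[ zero ]) x = x
  (F ^[ suc n ]) x = F ((F ^[ n ]) x)

  ⟦_⟧[_] : List Carrier → (Carrier → Carrier) → Carrier
  ⟦ [] ⟧[ G ] = ε
  ⟦ s ∷ σ ⟧[ G ] = s ∙ G (⟦ σ ⟧[ G ])

  -- A finite set Σ ⊆ Γ is given as an injective (w.r.t. ≈) enumeration
  -- Fin k → Γ, so strings over Σ are lists over Fin k.
  record IsSpanningSet (G : Carrier → Carrier) (k : ℕ) (Σ′ : Fin k → Carrier)
         : Set (c ⊔ ℓ) where
    field
      enum-injective : Injective _≡_ _≈_ Σ′
      spans     : ∀ a → ∃[ σ ] (⟦ map Σ′ σ ⟧[ G ] ≈ a)
      has-zero  : ∃[ i ] (Σ′ i ≈ ε)
      symmetric : ∀ i → ∃[ j ] (Σ′ j ≈ (Σ′ i) ⁻¹)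
      sum5      : ∀ a₁ a₂ a₃ a₄ a₅ → ∃[ b ] ∃[ b′ ]
                    (Σ′ a₁ ∙ Σ′ a₂ ∙ Σ′ a₃ ∙ Σ′ a₄ ∙ Σ′ a₅ ≈ Σ′ b ∙ G (Σ′ b′))
      sum3      : ∀ a₁ a₂ a₃ → (∃[ y ] (Σ′ a₁ ∙ Σ′ a₂ ∙ Σ′ a₃ ≈ G y)) →
                    ∃[ b ] (Σ′ a₁ ∙ Σ′ a₂ ∙ Σ′ a₃ ≈ G (Σ′ b))

  HasSpanningSet : (Carrier → Carrier) → Set (c ⊔ ℓ)
  HasSpanningSet G = Σ[ k ∈ ℕ ] Σ[ Σ′ ∈ (Fin k → Carrier) ] IsSpanningSet G k Σ′

  Respects≈ : (Carrier → Bool) → Set (c ⊔ ℓ)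
  Respects≈ A = ∀ {x y} → x ≈ y → A x ≡ A y

  IsAutomatic : (Carrier → Carrier) → (Carrier → Bool) → Set (c ⊔ ℓ)
  IsAutomatic F A =
    Σ[ r ∈ ℕ ] (0 < r × Σ[ k ∈ ℕ ] Σ[ Σ′ ∈ (Fin k → Carrier) ]
      (IsSpanningSet (F ^[ r ]) k Σ′ ×
       IsRegular k (λ σ → A (⟦ map Σ′ σ ⟧[ F ^[ r ] ]))))

  -- A_{s₀⋯s_{n-1}} x = A (s₀ + F s₁ + ⋯ + F^{n-1} s_{n-1} + Fⁿ x)
  -- (computed as s₀ + F(s₁ + F(⋯ + F x)), equal up to ≈ since F is a hom)
  section : (Carrier → Carrier) → (Carrier → Bool) → List Carrier → Carrier → Bool
  section F A [] = A
  section F A (s ∷ σ) = section F (λ x → A (s ∙ F x)) σ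

  ContainsCosetReps : (Carrier → Carrier) → (m : ℕ) → (Fin m → Carrier) → Set (c ⊔ ℓ)
  ContainsCosetReps F m S = ∀ x → ∃[ i ] ∃[ y ] (x ∙ (S i) ⁻¹ ≈ F y)

  KernelFinite : (Carrier → Carrier) → (m : ℕ) → (Fin m → Carrier) →
                 (Carrier → Bool) → Set c
  KernelFinite F m S A =
    Σ[ n ∈ ℕ ] Σ[ B ∈ (Fin n → Carrier → Bool) ]
      (∀ (σ : List (Fin m)) → ∃[ i ] (∀ x → section F A (map S σ) x ≡ B i x))

-- Write G = F^r and A_σ x = A([σ]_F + F^|σ| x).  If the (S,F)-kernel is finite, an automaton reading
-- base-G digits from the spanning set Σ keeps a kernel element A_w together with a carry: a new digit d
-- is added to the carry, the sum is expanded by coset representatives as [s]_F + G y with |s| = r, the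
-- state moves to A_{ws}, and condition (iv) keeps y expressible with boundedly many digits.  Pigeonhole
-- on prefixes shows that every A_w is A_w′ for some |w′| bounded by the size of the kernel, so there are
-- finitely many states.  Conversely, if an automaton M recognises A in base G, a word σ over S is
-- converted block by block into base-G digits π, a carry τ of bounded length (condition (iii)) and fewer
-- than r pending letters β; then A_σ is determined by the state of M after π together with τ and β.
module Submission where

open import Defs
open import Level using (Level)
open import Algebra.Bundles using (AbelianGroup)
import Algebra.Morphism.Construct.Composition as Composition
import Algebra.Morphism.Construct.Identity as Identity
open import Data.Bool using (Bool)
open import Data.Fin using (Fin; zero; suc; toℕ; fromℕ<)
open import Data.Fin.Properties using (*↔×; toℕ-fromℕ<; toℕ≤pred[n]; pigeonhole)
open import Data.List using (List; []; _∷_; _++_; _∷ʳ_; map; foldl; length; take; drop)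
open import Data.List.Properties using (map-++; length-map; foldl-++; foldl-∷ʳ; length-++; take++drop≡id; length-drop)
open import Data.List.Reverse using (Reverse; []; _∶_∶ʳ_; reverseView)
open import Data.Nat using (ℕ; zero; suc; _*_; _⊔_; _<_; _≤_; z≤n; s≤s; _≤?_)
open import Data.Nat.Properties
  using (≤-trans; ≤-reflexive; <⇒≤; n<1+n; m≤m⊔n; m≤n⊔m; m∸n≤m; +-comm; n≤1+n; ≰⇒>; m≤n⇒m<n∨m≡n)
open import Data.Nat.Induction using (<-wellFounded)
open import Induction.WellFounded using (Acc; acc)
open import Data.Product using (Σ-syntax; ∃-syntax; _×_; _,_; proj₁; proj₂; uncurry)
open import Data.Product.Function.NonDependent.Propositional using (_×-↔_)
open import Data.Sum using (inj₁; inj₂)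
open import Data.Vec using (Vec; []; _∷_; toList)
open import Data.Vec.Properties using (length-toList)
open import Function.Base using (_∘_)
open import Function.Bundles using (_⇔_; _↔_; mk⇔; mk↔ₛ′; Inverse)
open import Function.Properties.Inverse using (↔-refl; ↔-trans)
import Relation.Binary.PropositionalEquality as ≡
import Relation.Binary.Reasoning.Setoid
open ≡ using (_≡_; _≗_)
open import Relation.Nullary using (yes; no)

private
  variable
    X : Set
    k n R : ℕ

Finite : Set → Set
Finite X = Σ[ n ∈ ℕ ] (Fin n ↔ X)

finite-× : ∀ {Y : Set} → Finite X → Finite Y → Finite (X × Y)
finite-× (n₁ , e₁) (n₂ , e₂) = n₁ * n₂ , ↔-trans *↔× (e₁ ×-↔ e₂)

finite-Vec : Finite X → ∀ n → Finite (Vec X n)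
finite-Vec _ zero = 1 , mk↔ₛ′ (λ _ → []) (λ _ → zero) (λ { [] → ≡.refl }) (λ { zero → ≡.refl })
finite-Vec fin (suc n) with N , e ← finite-× fin (finite-Vec fin n) = N , ↔-trans e ×↔Vec
  where
    ×↔Vec : (X × Vec X n) ↔ Vec X (suc n)
    ×↔Vec = mk↔ₛ′ (uncurry _∷_) (λ { (x ∷ v) → x , v }) (λ { (x ∷ v) → ≡.refl }) (λ _ → ≡.refl)

finite-Fin : ∀ n → Finite (Fin n)
finite-Fin n = n , ↔-refl

Fin-bounded : ∀ n (f : Fin n → ℕ) → ∃[ K ] (∀ i → f i ≤ K)
Fin-bounded zero f = 0 , λ ()
Fin-bounded (suc n) f with K , f≤K ← Fin-bounded n (f ∘ suc) =
  f zero ⊔ K , λ { zero → m≤m⊔n _ _ ; (suc i) → ≤-trans (f≤K i) (m≤n⊔m _ _) }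

finite-bounded : Finite X → (f : X → ℕ) → ∃[ K ] (∀ x → f x ≤ K)
finite-bounded (n , e) f with K , f≤K ← Fin-bounded n (f ∘ Inverse.to e) =
  K , λ x → ≡.subst (λ y → f y ≤ K) (Inverse.strictlyInverseˡ e x) (f≤K (Inverse.from e x))

pad : X → ∀ n → List X → Vec X n
pad a zero    _       = []
pad a (suc n) []      = a ∷ pad a n []
pad a (suc n) (x ∷ w) = x ∷ pad a n w

take-length-pad : ∀ (a : X) n w → length w ≤ n → take (length w) (toList (pad a n w)) ≡ w
take-length-pad a zero    []      _         = ≡.refl
take-length-pad a (suc n) []      _         = ≡.refl
take-length-pad a (suc n) (x ∷ w) (s≤s le) = ≡.cong (x ∷_) (take-length-pad a n w le)

-- Words of length at most R, padded to length R and stored with their length.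
ShortWord : Set → ℕ → Set
ShortWord X R = Fin (suc R) × Vec X R

word : ShortWord X R → List X
word (j , v) = take (toℕ j) (toList v)

encode : X → (w : List X) → length w ≤ R → ShortWord X R
encode a w le = fromℕ< (s≤s le) , pad a _ w

word-encode : ∀ (a : X) w (le : length w ≤ R) → word (encode a w le) ≡ w
word-encode a w le =
  ≡.trans (≡.cong (λ j → take j (toList (pad a _ w))) (toℕ-fromℕ< (s≤s le))) (take-length-pad a _ w le)

finite-ShortWord : Finite X → ∀ R → Finite (ShortWord X R)
finite-ShortWord fin R = finite-× (finite-Fin (suc R)) (finite-Vec fin R)

length-∷ʳ : ∀ (w : List X) x → length (w ∷ʳ x) ≡ suc (length w)
length-∷ʳ w x = ≡.trans (length-++ w) (+-comm (length w) 1)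

length-take++drop : ∀ {a b} (w : List X) → a < b → b ≤ length w → length (take a w ++ drop b w) < length w
length-take++drop {a = zero}  {suc b} (x ∷ w) _         _         =
  s≤s (≤-trans (≤-reflexive (length-drop b w)) (m∸n≤m _ b))
length-take++drop {a = suc a} {suc b} (x ∷ w) (s≤s a<b) (s≤s b≤w) = s≤s (length-take++drop w a<b b≤w)

finiteAutomaton⇒regular : ∀ {Q : Set} {L : List (Fin k) → Bool} → Finite Q →
  (δ : Q → Fin k → Q) (q₀ : Q) (accept : Q → Bool) →
  (∀ w → accept (foldl δ q₀ w) ≡ L w) → IsRegular k L
finiteAutomaton⇒regular {k = k} (n , e) δ q₀ accept correct = M , λ w →
  ≡.trans (≡.cong (accept ∘ to) (run-from q₀ w)) (≡.trans (≡.cong accept (strictlyInverseˡ _)) (correct w))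
  where
    open Inverse e
    M : DFA k
    M = record { nStates = n ; δ = λ i a → from (δ (to i) a) ; start = from q₀ ; accept = accept ∘ to }
    run-from : ∀ q w → foldl (DFA.δ M) (from q) w ≡ from (foldl δ q w)
    run-from q []      = ≡.refl
    run-from q (a ∷ w) =
      ≡.trans (≡.cong (λ q′ → foldl (DFA.δ M) (from (δ q′ a)) w) (strictlyInverseˡ q)) (run-from (δ q a) w)

module _ {c ℓ : Level} (Γ : AbelianGroup c ℓ) where
  open AbelianGroup Γ
  open import Algebra.Morphism.Structures using (module GroupMorphisms)
  open import Algebra.Properties.Group group using (//-rightDividesˡ; //-rightDividesʳ)
  open import Algebra.Properties.CommutativeSemigroup commutativeSemigroup using (interchange; x∙yz≈xz∙y)
  private module ≈-Reasoning = Relation.Binary.Reasoning.Setoid setoid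

  iterate-injectiveEndo : ∀ {F} → IsInjectiveEndo Γ F → ∀ n → IsInjectiveEndo Γ (_^[_] Γ F n)
  iterate-injectiveEndo F-mono zero    = Identity.isGroupMonomorphism rawGroup refl
  iterate-injectiveEndo F-mono (suc n) =
    Composition.isGroupMonomorphism trans (iterate-injectiveEndo F-mono n) F-mono

  x≈y∙w⁻¹ : ∀ {x w y} → x ∙ w ≈ y → x ≈ y ∙ w ⁻¹
  x≈y∙w⁻¹ {x} {w} x∙w≈y = trans (sym (//-rightDividesʳ w x)) (∙-congʳ x∙w≈y)

  nest : (Carrier → Carrier) → List Carrier → Carrier → Carrier
  nest G []      z = z
  nest G (s ∷ σ) z = s ∙ G (nest G σ z)

  nest-++ : ∀ G u v z → nest G (u ++ v) z ≡ nest G u (nest G v z)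
  nest-++ G []      v z = ≡.refl
  nest-++ G (s ∷ u) v z = ≡.cong (λ y → s ∙ G y) (nest-++ G u v z)

  ⟦⟧≡nest : ∀ G σ → ⟦_⟧[_] Γ σ G ≡ nest G σ ε
  ⟦⟧≡nest G []      = ≡.refl
  ⟦⟧≡nest G (s ∷ σ) = ≡.cong (λ y → s ∙ G y) (⟦⟧≡nest G σ)

  nest-map-∷ʳ : ∀ G (D : X → Carrier) π d z → nest G (map D (π ∷ʳ d)) z ≡ nest G (map D π) (D d ∙ G z)
  nest-map-∷ʳ G D π d z = ≡.trans (≡.cong (λ l → nest G l z) (map-++ D π (d ∷ []))) (nest-++ G (map D π) _ z)

  section≡nest : ∀ F A σ z → section Γ F A σ z ≡ A (nest F σ z)
  section≡nest F A []      z = ≡.refl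
  section≡nest F A (s ∷ σ) z = section≡nest F (λ x → A (s ∙ F x)) σ z

  section-++ : ∀ F A u v → section Γ F A (u ++ v) ≗ section Γ F (section Γ F A u) v
  section-++ F A []      v = λ _ → ≡.refl
  section-++ F A (s ∷ u) v = section-++ F (λ x → A (s ∙ F x)) u v

  module _ {G : Carrier → Carrier} (G-mono : IsInjectiveEndo Γ G) where
    open GroupMorphisms.IsGroupMonomorphism G-mono using (⟦⟧-cong; ∙-homo; ε-homo; ⁻¹-homo)

    nest-cong : ∀ σ {z z′} → z ≈ z′ → nest G σ z ≈ nest G σ z′
    nest-cong []      z≈z′ = z≈z′
    nest-cong (s ∷ σ) z≈z′ = ∙-congˡ (⟦⟧-cong (nest-cong σ z≈z′))

    nest-homo : ∀ σ z → nest G σ z ≈ nest G σ ε ∙ _^[_] Γ G (length σ) z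
    nest-homo []      z = sym (identityˡ z)
    nest-homo (s ∷ σ) z = begin
      s ∙ G (nest G σ z)                              ≈⟨ ∙-congˡ (⟦⟧-cong (nest-homo σ z)) ⟩
      s ∙ G (nest G σ ε ∙ _^[_] Γ G (length σ) z)     ≈⟨ ∙-congˡ (∙-homo _ _) ⟩
      s ∙ (G (nest G σ ε) ∙ G (_^[_] Γ G (length σ) z)) ≈⟨ assoc _ _ _ ⟨
      s ∙ G (nest G σ ε) ∙ G (_^[_] Γ G (length σ) z) ∎
      where open ≈-Reasoning

    module Digits {k : ℕ} (D : Fin k → Carrier) (spanning : IsSpanningSet Γ G k D) where
      open IsSpanningSet spanning

      ⟦_⟧ : List (Fin k) → Carrier
      ⟦ w ⟧ = ⟦_⟧[_] Γ (map D w) G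

      val : Vec (Fin k) n → Carrier
      val τ = ⟦ toList τ ⟧

      digits : Carrier → List (Fin k)
      digits a = proj₁ (spans a)

      digits-correct : ∀ a → ⟦ digits a ⟧ ≈ a
      digits-correct a = proj₂ (spans a)

      zeroDigit : Fin k
      zeroDigit = proj₁ has-zero

      D[zeroDigit]≈ε : D zeroDigit ≈ ε
      D[zeroDigit]≈ε = proj₂ has-zero

      zeroDigit-identityˡ : ∀ x → D zeroDigit ∙ x ≈ x
      zeroDigit-identityˡ x = trans (∙-congʳ D[zeroDigit]≈ε) (identityˡ x)

      zeroDigit-identityʳ : ∀ x → x ∙ D zeroDigit ≈ x
      zeroDigit-identityʳ x = trans (∙-congˡ D[zeroDigit]≈ε) (identityʳ x)

      ⟦⟧-++ : ∀ u v → ⟦ u ++ v ⟧ ≡ nest G (map D u) ⟦ v ⟧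
      ⟦⟧-++ []      v = ≡.refl
      ⟦⟧-++ (d ∷ u) v = ≡.cong (λ y → D d ∙ G y) (⟦⟧-++ u v)

      val-pad : ∀ n w → length w ≤ n → val (pad zeroDigit n w) ≈ ⟦ w ⟧
      val-pad zero    []      _        = refl
      val-pad (suc n) []      _        =
        trans (∙-cong D[zeroDigit]≈ε (trans (⟦⟧-cong (val-pad n [] z≤n)) ε-homo)) (identityˡ ε)
      val-pad (suc n) (d ∷ w) (s≤s le) = ∙-congˡ (⟦⟧-cong (val-pad n w le))

      -- Condition (iii) of a spanning set, applied digitwise with two zero summands.
      add-with-carry : ∀ {K} d (τ υ : Vec (Fin k) K) →
                       Σ[ τ′ ∈ Vec (Fin k) (suc K) ] (D d ∙ val τ ∙ val υ ≈ val τ′)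
      add-with-carry d []      []      = (d ∷ []) , trans (identityʳ _) (∙-congˡ (sym ε-homo))
      add-with-carry d (a ∷ τ) (b ∷ υ) =
        let e , d′ , sum≈ = sum5 d a b zeroDigit zeroDigit
            τ′ , carry≈ = add-with-carry d′ τ υ
        in (e ∷ τ′) , (begin
          D d ∙ (D a ∙ G (val τ)) ∙ (D b ∙ G (val υ))      ≈⟨ ∙-congʳ (assoc _ _ _) ⟨
          (D d ∙ D a ∙ G (val τ)) ∙ (D b ∙ G (val υ))      ≈⟨ interchange _ _ _ _ ⟩
          (D d ∙ D a ∙ D b) ∙ (G (val τ) ∙ G (val υ))       ≈⟨ ∙-cong (trans (zeroDigit-identityʳ _) (zeroDigit-identityʳ _))
                                                                  (∙-homo _ _) ⟨
          (D d ∙ D a ∙ D b ∙ D zeroDigit ∙ D zeroDigit) ∙ G (val τ ∙ val υ) ≈⟨ ∙-congʳ sum≈ ⟩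
          (D e ∙ G (D d′)) ∙ G (val τ ∙ val υ)              ≈⟨ assoc _ _ _ ⟩
          D e ∙ (G (D d′) ∙ G (val τ ∙ val υ))              ≈⟨ ∙-congˡ (∙-homo _ _) ⟨
          D e ∙ G (D d′ ∙ (val τ ∙ val υ))                  ≈⟨ ∙-congˡ (⟦⟧-cong (trans (sym (assoc _ _ _)) carry≈)) ⟩
          D e ∙ G (val τ′)                                  ∎)
        where open ≈-Reasoning

      -- Condition (iv) of a spanning set, applied to the lowest digits; the rest is added back with carry.
      divide : ∀ {K} (τ : Vec (Fin k) (suc K)) d (υ : Vec (Fin k) (suc K)) →
               (∃[ y ] (val τ ∙ D d ∙ val υ ≈ G y)) →
               Σ[ τ′ ∈ Vec (Fin k) (suc K) ] (val τ ∙ D d ∙ val υ ≈ G (val τ′))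
      divide (a ∷ τ) d (b ∷ υ) (y , ≈Gy) =
        let γ , low≈ = sum3 a d b (y ∙ (val τ ∙ val υ) ⁻¹ , low-in-GΓ)
            τ′ , carry≈ = add-with-carry γ τ υ
        in τ′ , (begin
          val (a ∷ τ) ∙ D d ∙ val (b ∷ υ)         ≈⟨ regroup ⟩
          (D a ∙ D d ∙ D b) ∙ G (val τ ∙ val υ)  ≈⟨ ∙-congʳ low≈ ⟩
          G (D γ) ∙ G (val τ ∙ val υ)            ≈⟨ ∙-homo _ _ ⟨
          G (D γ ∙ (val τ ∙ val υ))              ≈⟨ ⟦⟧-cong (trans (sym (assoc _ _ _)) carry≈) ⟩
          G (val τ′)                             ∎)
        where
          open ≈-Reasoning
          regroup : val (a ∷ τ) ∙ D d ∙ val (b ∷ υ) ≈ (D a ∙ D d ∙ D b) ∙ G (val τ ∙ val υ)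
          regroup = begin
            (D a ∙ G (val τ)) ∙ D d ∙ (D b ∙ G (val υ))  ≈⟨ ∙-congʳ (trans (assoc _ _ _) (x∙yz≈xz∙y _ _ _)) ⟩
            (D a ∙ D d ∙ G (val τ)) ∙ (D b ∙ G (val υ))  ≈⟨ interchange _ _ _ _ ⟩
            (D a ∙ D d ∙ D b) ∙ (G (val τ) ∙ G (val υ))  ≈⟨ ∙-congˡ (∙-homo _ _) ⟨
            (D a ∙ D d ∙ D b) ∙ G (val τ ∙ val υ)        ∎
          low-in-GΓ : D a ∙ D d ∙ D b ≈ G (y ∙ (val τ ∙ val υ) ⁻¹)
          low-in-GΓ = begin
            D a ∙ D d ∙ D b                        ≈⟨ x≈y∙w⁻¹ (trans (sym regroup) ≈Gy) ⟩
            G y ∙ G (val τ ∙ val υ) ⁻¹             ≈⟨ ∙-congˡ (⁻¹-homo _) ⟨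
            G y ∙ G ((val τ ∙ val υ) ⁻¹)           ≈⟨ ∙-homo _ _ ⟨
            G (y ∙ (val τ ∙ val υ) ⁻¹)             ∎

  module _ {F : Carrier → Carrier} (F-mono : IsInjectiveEndo Γ F)
           {m : ℕ} (S : Fin m → Carrier) (reps : ContainsCosetReps Γ F m S) where
    open GroupMorphisms.IsGroupMonomorphism F-mono using (⟦⟧-cong)

    nestS : List (Fin m) → Carrier → Carrier
    nestS w = nest F (map S w)

    nestS-block : ∀ r w z → length w ≡ r → nestS w z ≈ nestS w ε ∙ _^[_] Γ F r z
    nestS-block r w z ≡.refl =
      ≡.subst (λ l → nestS w z ≈ nestS w ε ∙ _^[_] Γ F l z) (length-map S w) (nest-homo F-mono (map S w) z)

    nestS-block-∙ : ∀ r w y z → length w ≡ r → nestS w (y ∙ z) ≈ nestS w y ∙ _^[_] Γ F r z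
    nestS-block-∙ r w y z |w|≡r = begin
      nestS w (y ∙ z)                 ≈⟨ nestS-block r w _ |w|≡r ⟩
      nestS w ε ∙ Fʳ (y ∙ z)          ≈⟨ ∙-congˡ (Fʳ.∙-homo y z) ⟩
      nestS w ε ∙ (Fʳ y ∙ Fʳ z)       ≈⟨ assoc _ _ _ ⟨
      (nestS w ε ∙ Fʳ y) ∙ Fʳ z       ≈⟨ ∙-congʳ (nestS-block r w y |w|≡r) ⟨
      nestS w y ∙ Fʳ z                ∎
      where
        open ≈-Reasoning
        Fʳ = _^[_] Γ F r
        module Fʳ = GroupMorphisms.IsGroupMonomorphism (iterate-injectiveEndo F-mono r)

    s₀ : Fin m
    s₀ = proj₁ (reps ε)

    coset-expansion : ∀ j y → Σ[ s ∈ Vec (Fin m) j ] Σ[ y′ ∈ Carrier ] (y ≈ nestS (toList s) y′)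
    coset-expansion zero    y = [] , y , refl
    coset-expansion (suc j) y =
      let i , y₁ , y-Sᵢ≈Fy₁ = reps y
          s , y′ , y₁≈ = coset-expansion j y₁
      in (i ∷ s) , y′ , (begin
        y                       ≈⟨ //-rightDividesˡ (S i) y ⟨
        y ∙ S i ⁻¹ ∙ S i        ≈⟨ comm _ _ ⟩
        S i ∙ (y ∙ S i ⁻¹)      ≈⟨ ∙-congˡ y-Sᵢ≈Fy₁ ⟩
        S i ∙ F y₁              ≈⟨ ∙-congˡ (⟦⟧-cong y₁≈) ⟩
        S i ∙ F (nestS (toList s) y′) ∎)
      where open ≈-Reasoning

    module _ (A : Carrier → Bool) (A-resp : Respects≈ Γ A) where

      sectionS : List (Fin m) → Carrier → Bool
      sectionS w = section Γ F A (map S w)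

      sectionS-resp : ∀ w {x y} → x ≈ y → sectionS w x ≡ sectionS w y
      sectionS-resp w {x} {y} x≈y = begin
        sectionS w x           ≡⟨ section≡nest F A (map S w) x ⟩
        A (nestS w x)          ≡⟨ A-resp (nest-cong F-mono (map S w) x≈y) ⟩
        A (nestS w y)          ≡⟨ section≡nest F A (map S w) y ⟨
        sectionS w y           ∎
        where open ≡.≡-Reasoning

      sectionS-++ : ∀ u v y → sectionS (u ++ v) y ≡ sectionS u (nestS v y)
      sectionS-++ u v y = begin
        section Γ F A (map S (u ++ v)) y            ≡⟨ ≡.cong (λ l → section Γ F A l y) (map-++ S u v) ⟩
        section Γ F A (map S u ++ map S v) y        ≡⟨ section-++ F A (map S u) (map S v) y ⟩
        section Γ F (sectionS u) (map S v) y        ≡⟨ section≡nest F (sectionS u) (map S v) y ⟩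
        sectionS u (nestS v y)                      ∎
        where open ≡.≡-Reasoning

      module KernelFinite⇒Automatic (n : ℕ) (B : Fin n → Carrier → Bool)
               (kernel : ∀ σ → ∃[ i ] (∀ x → section Γ F A (map S σ) x ≡ B i x)) where

        κ : List (Fin m) → Fin n
        κ σ = proj₁ (kernel σ)

        -- Two of the n + 1 prefixes of σ of length ≤ n have the same section; cut out the word between them.
        excise : ∀ σ → n < length σ → Σ[ σ′ ∈ List (Fin m) ] (length σ′ < length σ × sectionS σ′ ≗ sectionS σ)
        excise σ n<σ with i , j , i<j , κᵢ≡κⱼ ← pigeonhole (n<1+n n) (λ j → κ (take (toℕ j) σ)) =
          take a σ ++ drop b σ , length-take++drop σ i<j (≤-trans (toℕ≤pred[n] j) (<⇒≤ n<σ)) , λ x → begin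
            sectionS (take a σ ++ drop b σ) x          ≡⟨ sectionS-++ (take a σ) _ x ⟩
            sectionS (take a σ) (nestS (drop b σ) x)   ≡⟨ proj₂ (kernel (take a σ)) _ ⟩
            B (κ (take a σ)) (nestS (drop b σ) x)      ≡⟨ ≡.cong (λ l → B l (nestS (drop b σ) x)) κᵢ≡κⱼ ⟩
            B (κ (take b σ)) (nestS (drop b σ) x)      ≡⟨ proj₂ (kernel (take b σ)) _ ⟨
            sectionS (take b σ) (nestS (drop b σ) x)   ≡⟨ sectionS-++ (take b σ) _ x ⟨
            sectionS (take b σ ++ drop b σ) x          ≡⟨ ≡.cong (λ w → sectionS w x) (take++drop≡id b σ) ⟩
            sectionS σ x                               ∎
          where
            open ≡.≡-Reasoning
            a = toℕ i
            b = toℕ j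

        short-representative : ∀ σ → Acc _<_ (length σ) →
                               Σ[ w ∈ List (Fin m) ] (length w ≤ n × sectionS w ≗ sectionS σ)
        short-representative σ (acc rec) with length σ ≤? n
        ... | yes σ≤n = σ , σ≤n , λ _ → ≡.refl
        ... | no σ≰n with σ′ , σ′<σ , σ′≗σ ← excise σ (≰⇒> σ≰n)
          with w , w≤n , w≗σ′ ← short-representative σ′ (rec σ′<σ) =
          w , w≤n , λ x → ≡.trans (w≗σ′ x) (σ′≗σ x)

        shorten : List (Fin m) → ShortWord (Fin m) n
        shorten σ with w , w≤n , _ ← short-representative σ (<-wellFounded _) = encode s₀ w w≤n

        sectionS-shorten : ∀ σ → sectionS (word (shorten σ)) ≗ sectionS σ
        sectionS-shorten σ x with w , w≤n , w≗σ ← short-representative σ (<-wellFounded _) =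
          ≡.trans (≡.cong (λ v → sectionS v x) (word-encode s₀ w w≤n)) (w≗σ x)

        module _ (r : ℕ) {k : ℕ} (D : Fin k → Carrier) (spanning : IsSpanningSet Γ (_^[_] Γ F r) k D) where
          private
            G = _^[_] Γ F r
            G-mono = iterate-injectiveEndo F-mono r
            module G = GroupMorphisms.IsGroupMonomorphism G-mono
          open Digits G-mono D spanning

          block : Vec (Fin m) r → Carrier
          block s = nestS (toList s) ε

          negated-block-bound : ∃[ K ] (∀ s → length (digits (block s ⁻¹)) ≤ K)
          negated-block-bound = finite-bounded (finite-Vec (finite-Fin m) r) (λ s → length (digits (block s ⁻¹)))

          -- One spare digit: divide needs carries of positive length.
          K : ℕ
          K = suc (proj₁ negated-block-bound)

          negated-block : Vec (Fin m) r → Vec (Fin k) K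
          negated-block s = pad zeroDigit K (digits (block s ⁻¹))

          val-negated-block : ∀ s → val (negated-block s) ≈ block s ⁻¹
          val-negated-block s =
            trans (val-pad K (digits (block s ⁻¹)) (≤-trans (proj₂ negated-block-bound s) (n≤1+n _))) (digits-correct _)

          cancel-block : ∀ {y} s y′ → y ≈ nestS (toList s) y′ → y ∙ val (negated-block s) ≈ G y′
          cancel-block {y} s y′ y≈ = begin
            y ∙ val (negated-block s)   ≈⟨ ∙-cong (trans y≈ (nestS-block r (toList s) y′ (length-toList s)))
                                                  (val-negated-block s) ⟩
            (block s ∙ G y′) ∙ block s ⁻¹ ≈⟨ ∙-congʳ (comm _ _) ⟩
            (G y′ ∙ block s) ∙ block s ⁻¹ ≈⟨ //-rightDividesʳ _ _ ⟩
            G y′                          ∎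
            where open ≈-Reasoning

          -- By coset expansion τ + d = [s]_F + G y′; adding the digits of −[s]_F makes the sum divisible
          -- by G, so divide writes y′ with K digits.
          carry-step : (τ : Vec (Fin k) K) (d : Fin k) →
                       Σ[ s ∈ Vec (Fin m) r ] Σ[ τ′ ∈ Vec (Fin k) K ] (val τ ∙ D d ≈ nestS (toList s) (val τ′))
          carry-step τ d =
            let s , y′ , y≈ = coset-expansion r (val τ ∙ D d)
                τ′ , ≈Gτ′ = divide τ d (negated-block s) (y′ , cancel-block s y′ y≈)
            in s , τ′ , trans y≈ (nest-cong F-mono (map S (toList s))
                                   (G.injective (trans (sym (cancel-block s y′ y≈)) ≈Gτ′)))

          State : Set
          State = ShortWord (Fin m) n × Vec (Fin k) K

          step : State → Fin k → State
          step (e , τ) d = let s , τ′ , _ = carry-step τ d in shorten (word e ++ toList s) , τ′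

          start : State
          start = shorten [] , pad zeroDigit K []

          accepting : State → Bool
          accepting (e , τ) = sectionS (word e) (val τ)

          Tracks : List (Fin k) → State → Set c
          Tracks π (e , τ) = ∀ x → A (nest G (map D π) x) ≡ sectionS (word e) (val τ ∙ x)

          tracks-start : Tracks [] start
          tracks-start x = ≡.trans (A-resp (sym (trans (∙-congʳ (val-pad K [] z≤n)) (identityˡ x))))
                                   (≡.sym (sectionS-shorten [] (val (pad zeroDigit K []) ∙ x)))

          tracks-step : ∀ π q d → Tracks π q → Tracks (π ∷ʳ d) (step q d)
          tracks-step π (e , τ) d π-tracked x =
            let s , τ′ , τd≈ = carry-step τ d
                absorb : val τ ∙ (D d ∙ G x) ≈ nestS (toList s) (val τ′ ∙ x)
                absorb = trans (sym (assoc _ _ _))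
                           (trans (∙-congʳ τd≈) (sym (nestS-block-∙ r (toList s) _ x (length-toList s))))
            in begin
              A (nest G (map D (π ∷ʳ d)) x)                       ≡⟨ ≡.cong A (nest-map-∷ʳ G D π d x) ⟩
              A (nest G (map D π) (D d ∙ G x))                    ≡⟨ π-tracked _ ⟩
              sectionS (word e) (val τ ∙ (D d ∙ G x))             ≡⟨ sectionS-resp (word e) absorb ⟩
              sectionS (word e) (nestS (toList s) (val τ′ ∙ x))   ≡⟨ sectionS-++ (word e) (toList s) _ ⟨
              sectionS (word e ++ toList s) (val τ′ ∙ x)          ≡⟨ sectionS-shorten (word e ++ toList s) (val τ′ ∙ x) ⟨
              sectionS (word (shorten (word e ++ toList s))) (val τ′ ∙ x) ∎
            where open ≡.≡-Reasoning

          tracks-run : ∀ {π} → Reverse π → Tracks π (foldl step start π)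
          tracks-run []               = tracks-start
          tracks-run (π ∶ rev ∶ʳ d) =
            ≡.subst (Tracks (π ∷ʳ d)) (≡.sym (foldl-∷ʳ step start d π))
              (tracks-step π (foldl step start π) d (tracks-run rev))

          accepting-correct : ∀ π q → Tracks π q → accepting q ≡ A (⟦_⟧[_] Γ (map D π) G)
          accepting-correct π (e , τ) π-tracked = begin
            sectionS (word e) (val τ)         ≡⟨ sectionS-resp (word e) (identityʳ _) ⟨
            sectionS (word e) (val τ ∙ ε)     ≡⟨ π-tracked ε ⟨
            A (nest G (map D π) ε)            ≡⟨ ≡.cong A (⟦⟧≡nest G (map D π)) ⟨
            A (⟦_⟧[_] Γ (map D π) G)          ∎
            where open ≡.≡-Reasoning

          finite-State : Finite State
          finite-State = finite-× (finite-ShortWord (finite-Fin m) n) (finite-Vec (finite-Fin k) K)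

          regular : IsRegular k (λ π → A (⟦_⟧[_] Γ (map D π) G))
          regular = finiteAutomaton⇒regular finite-State step start accepting
                      (λ π → accepting-correct π (foldl step start π) (tracks-run (reverseView π)))

      module Automatic⇒KernelFinite (r : ℕ) (r>0 : 0 < r) {k : ℕ} (D : Fin k → Carrier)
               (spanning : IsSpanningSet Γ (_^[_] Γ F r) k D) (M : DFA k)
               (M-accepts : ∀ w → DFA.accepts M w ≡ A (⟦_⟧[_] Γ (map D w) (_^[_] Γ F r))) where
        private
          G = _^[_] Γ F r
          G-mono = iterate-injectiveEndo F-mono r
          module G = GroupMorphisms.IsGroupMonomorphism G-mono
        open Digits G-mono D spanning

        block-bound : ∃[ K ] (∀ e → length (digits (nestS (word e) ε)) ≤ K)
        block-bound = finite-bounded (finite-ShortWord (finite-Fin m) r) (λ e → length (digits (nestS (word e) ε)))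

        K : ℕ
        K = proj₁ block-bound

        block-digits : List (Fin m) → Vec (Fin k) K
        block-digits β = pad zeroDigit K (digits (nestS β ε))

        val-block-digits : ∀ β → length β ≤ r → val (block-digits β) ≈ nestS β ε
        val-block-digits β le = trans (val-pad K (digits (nestS β ε)) bounded) (digits-correct _)
          where
            bounded : length (digits (nestS β ε)) ≤ K
            bounded = ≡.subst (λ w → length (digits (nestS w ε)) ≤ K) (word-encode s₀ β le)
                        (proj₂ block-bound (encode s₀ β le))

        Decomposition : List (Fin m) → Set (c Level.⊔ ℓ)
        Decomposition σ = Σ[ π ∈ List (Fin k) ] Σ[ τ ∈ Vec (Fin k) K ] Σ[ β ∈ List (Fin m) ]
          (length β < r × (∀ x → nestS σ x ≈ nest G (map D π) (val τ ∙ nestS β x)))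

        decomposition-[] : Decomposition []
        decomposition-[] = [] , pad zeroDigit K [] , [] , r>0 , λ x →
          sym (trans (∙-congʳ (val-pad K [] z≤n)) (identityˡ x))

        flush : ∀ τ β → length β ≡ r →
                Σ[ d ∈ Fin k ] Σ[ τ′ ∈ Vec (Fin k) K ] (∀ x → val τ ∙ nestS β x ≈ D d ∙ G (val τ′ ∙ x))
        flush τ β |β|≡r with (d ∷ τ′) , carry≈ ← add-with-carry zeroDigit τ (block-digits β) =
          d , τ′ , λ x → begin
            val τ ∙ nestS β x                               ≈⟨ ∙-congˡ (nestS-block r β x |β|≡r) ⟩
            val τ ∙ (nestS β ε ∙ G x)                       ≈⟨ ∙-congˡ (∙-congʳ (val-block-digits β (≤-reflexive |β|≡r))) ⟨
            val τ ∙ (val (block-digits β) ∙ G x)            ≈⟨ assoc _ _ _ ⟨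
            (val τ ∙ val (block-digits β)) ∙ G x            ≈⟨ ∙-congʳ (∙-congʳ (zeroDigit-identityˡ _)) ⟨
            (D zeroDigit ∙ val τ ∙ val (block-digits β)) ∙ G x ≈⟨ ∙-congʳ carry≈ ⟩
            (D d ∙ G (val τ′)) ∙ G x                        ≈⟨ assoc _ _ _ ⟩
            D d ∙ (G (val τ′) ∙ G x)                        ≈⟨ ∙-congˡ (G.∙-homo _ _) ⟨
            D d ∙ G (val τ′ ∙ x)                            ∎
          where open ≈-Reasoning

        extend-pending : ∀ {σ π} {τ : Vec (Fin k) K} {β} s →
                         (∀ x → nestS σ x ≈ nest G (map D π) (val τ ∙ nestS β x)) →
                         ∀ x → nestS (σ ∷ʳ s) x ≈ nest G (map D π) (val τ ∙ nestS (β ∷ʳ s) x)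
        extend-pending {σ} {π} {τ} {β} s σ≈ x = begin
          nestS (σ ∷ʳ s) x                               ≡⟨ nest-map-∷ʳ F S σ s x ⟩
          nestS σ (S s ∙ F x)                            ≈⟨ σ≈ _ ⟩
          nest G (map D π) (val τ ∙ nestS β (S s ∙ F x)) ≡⟨ ≡.cong (λ y → nest G (map D π) (val τ ∙ y))
                                                                  (nest-map-∷ʳ F S β s x) ⟨
          nest G (map D π) (val τ ∙ nestS (β ∷ʳ s) x)    ∎
          where open ≈-Reasoning

        decomposition-∷ʳ : ∀ σ s → Decomposition σ → Decomposition (σ ∷ʳ s)
        decomposition-∷ʳ σ s (π , τ , β , β<r , σ≈) with m≤n⇒m<n∨m≡n β<r
        ... | inj₁ β∷ʳs<r =
          π , τ , β ∷ʳ s , ≡.subst (_< r) (≡.sym (length-∷ʳ β s)) β∷ʳs<r , extend-pending {σ} {π} {τ} {β} s σ≈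
        ... | inj₂ β∷ʳs≡r with d , τ′ , flushed ← flush τ (β ∷ʳ s) (≡.trans (length-∷ʳ β s) β∷ʳs≡r) =
          π ∷ʳ d , τ′ , [] , r>0 , λ x → begin
            nestS (σ ∷ʳ s) x                              ≈⟨ extend-pending {σ} {π} {τ} {β} s σ≈ x ⟩
            nest G (map D π) (val τ ∙ nestS (β ∷ʳ s) x)   ≈⟨ nest-cong G-mono (map D π) (flushed x) ⟩
            nest G (map D π) (D d ∙ G (val τ′ ∙ x))       ≡⟨ nest-map-∷ʳ G D π d _ ⟨
            nest G (map D (π ∷ʳ d)) (val τ′ ∙ x)          ∎
          where open ≈-Reasoning

        decompose : ∀ {σ} → Reverse σ → Decomposition σ
        decompose []              = decomposition-[]
        decompose (σ ∶ rev ∶ʳ s) = decomposition-∷ʳ σ s (decompose rev)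

        Index : Set
        Index = Fin (DFA.nStates M) × Vec (Fin k) K × ShortWord (Fin m) r

        section-at : Index → Carrier → Bool
        section-at (q , τ , e) x = DFA.accept M (foldl (DFA.δ M) q (digits (val τ ∙ nestS (word e) x)))

        sectionS≗section-at : ∀ σ → Σ[ i ∈ Index ] (sectionS σ ≗ section-at i)
        sectionS≗section-at σ with π , τ , β , β<r , σ≈ ← decompose (reverseView σ) =
          (DFA.run M π , τ , encode s₀ β (<⇒≤ β<r)) , λ x → begin
            sectionS σ x                                 ≡⟨ section≡nest F A (map S σ) x ⟩
            A (nestS σ x)                                ≡⟨ A-resp (σ≈ x) ⟩
            A (nest G (map D π) (y x))                   ≡⟨ A-resp (nest-cong G-mono (map D π) (sym (digits-correct (y x)))) ⟩
            A (nest G (map D π) ⟦ digits (y x) ⟧)        ≡⟨ ≡.cong A (⟦⟧-++ π (digits (y x))) ⟨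
            A ⟦ π ++ digits (y x) ⟧                      ≡⟨ M-accepts (π ++ digits (y x)) ⟨
            DFA.accepts M (π ++ digits (y x))            ≡⟨ ≡.cong (DFA.accept M) (foldl-++ (DFA.δ M) (DFA.start M) π _) ⟩
            DFA.accept M (foldl (DFA.δ M) (DFA.run M π) (digits (y x)))
              ≡⟨ ≡.cong (λ w → DFA.accept M (foldl (DFA.δ M) (DFA.run M π) (digits (val τ ∙ nestS w x))))
                        (word-encode s₀ β (<⇒≤ β<r)) ⟨
            section-at (DFA.run M π , τ , encode s₀ β (<⇒≤ β<r)) x ∎
          where
            open ≡.≡-Reasoning
            y : Carrier → Carrier
            y x = val τ ∙ nestS β x

        kernelFinite : KernelFinite Γ F m S A
        finite-Index : Finite Index
        finite-Index = finite-× (finite-Fin _) (finite-× (finite-Vec (finite-Fin k) K) (finite-ShortWord (finite-Fin m) r))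

        kernelFinite with N , e ← finite-Index =
          N , section-at ∘ to , λ σ → let i , σ≗i = sectionS≗section-at σ in
            from i , λ x → ≡.trans (σ≗i x) (≡.cong (λ j → section-at j x) (≡.sym (strictlyInverseˡ i)))
          where open Inverse e

theorem4p2 : ∀ {c ℓ : Level} (Γ : AbelianGroup c ℓ) →
    IsInfinite Γ →
    (F : AbelianGroup.Carrier Γ → AbelianGroup.Carrier Γ) →
    IsInjectiveEndo Γ F →
    (Σ[ r ∈ ℕ ] (0 < r × HasSpanningSet Γ (_^[_] Γ F r))) →
    (m : ℕ) (S : Fin m → AbelianGroup.Carrier Γ) →
    ContainsCosetReps Γ F m S →
    (A : AbelianGroup.Carrier Γ → Bool) → Respects≈ Γ A →
    (IsAutomatic Γ F A ⇔ KernelFinite Γ F m S A)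
theorem4p2 Γ _ F F-mono (r , r>0 , k , D , spanning) m S reps A A-resp = mk⇔
  (λ (r′ , r′>0 , _ , D′ , spanning′ , M , M-accepts) →
    Automatic⇒KernelFinite.kernelFinite Γ F-mono S reps A A-resp r′ r′>0 D′ spanning′ M M-accepts)
  (λ (n , B , kernel) →
    r , r>0 , k , D , spanning , KernelFinite⇒Automatic.regular Γ F-mono S reps A A-resp n B kernel r D spanning)
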